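{- Let $G$ be the infinite grid graph with vertex set $\mathbb{Z}^2$ and $\sigma$ a distinguished face. Consider the flow-firing process for $(G,\sigma)$ in the face representation, started from any integer face configuration $F$. Then along the process: (1) the maximum value $\max_\tau F_\tau$ over all faces does not increase; (2) the minimum value $\min_\tau F_\tau$ over all faces does not decrease; (3) the value $F_\sigma$ does not change.
   Context: Faces of $G$ are the unit squares of $\mathbb{Z}^2$; two faces are neighbors if they share an edge. A face configuration is a function $F$ assigning an integer $F_\tau$ to each face $\tau$ (interpreted as a local circulation around $\tau$, positive meaning clockwise). Flow-firing process for $(G,\sigma)$ in the face representation: at each step choose two neighboring faces $a,b$, and: if $a\neq\sigma$, $b\neq\sigma$ and $F_a\ge F_b+2$, replace $F_a$ by $F_a-1$ and $F_b$ by $F_b+1$; if $b=\sigma$ and $F_\sigma>F_a$, replace $F_a$ by $F_a+1$; if $b=\sigma$ and $F_\sigma<F_a$, replace $F_a$ by $F_a-1$. No other moves are allowed. -}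

module Defs where

open import Data.Integer using (ℤ; _+_; _-_; _≤_; _<_; _>_; 1ℤ; _≟_)
open import Data.Product using (_×_; _,_)
open import Data.Product.Properties using (≡-dec)
open import Relation.Binary.PropositionalEquality using (_≡_; _≢_)
open import Relation.Binary.Definitions using (DecidableEquality)
open import Relation.Nullary using (yes; no)

-- A face of the grid graph Z^2 is a unit square, identified with its
-- lower-left corner (i , j) ∈ ℤ × ℤ.
Face : Set
Face = ℤ × ℤ

_≟F_ : DecidableEquality Face
_≟F_ = ≡-dec _≟_ _≟_

data Neighbor : Face → Face → Set where
  right : ∀ {x y} → Neighbor (x , y) (x + 1ℤ , y)
  left  : ∀ {x y} → Neighbor (x + 1ℤ , y) (x , y)
  up    : ∀ {x y} → Neighbor (x , y) (x , y + 1ℤ)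
  down  : ∀ {x y} → Neighbor (x , y + 1ℤ) (x , y)

Config : Set
Config = Face → ℤ

update : Config → Face → ℤ → Config
update F a v τ with τ ≟F a
... | yes _ = v
... | no  _ = F τ

data Step (σ : Face) (F : Config) : Config → Set where
  fire    : ∀ a b → Neighbor a b → a ≢ σ → b ≢ σ → F b + 1ℤ + 1ℤ ≤ F a →
            Step σ F (update (update F a (F a - 1ℤ)) b (F b + 1ℤ))
  sink-up : ∀ a → Neighbor a σ → F σ > F a →
            Step σ F (update F a (F a + 1ℤ))
  sink-dn : ∀ a → Neighbor a σ → F σ < F a →
            Step σ F (update F a (F a - 1ℤ))

Reach : Face → Config → Config → Set
Reach σ = Star (Step σ)
  where open import Relation.Binary.Construct.Closure.ReflexiveTransitive using (Star)

module Submission where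

-- Say that F' is *spanned* by F if every value F' τ lies
-- between two values of F, i.e. F α ≤ F' τ ≤ F β for some faces α, β.
-- Spannedness is reflexive and transitive, and any upper (lower) bound of F
-- is an upper (lower) bound of every configuration spanned by F.  Every
-- flow-firing move only overwrites values by numbers that lie between two
-- old values (a firing pair moves F a, F b towards each other, a sink move
-- moves F a towards F σ), so the new configuration is spanned by the old
-- one; moreover no move writes to the face σ.  Folding these two facts
-- along a reachability path gives all three claims of the proposition.

open import Defs
open import Data.Integer using (ℤ; _≤_; _<_; _+_; _-_; 1ℤ; -1ℤ)
open import Data.Integer.Properties
  using (≤-refl; ≤-trans; <-irrefl; +-comm; i≤suc[i]; i≤j⇒pred[i]≤j; i<j⇒suc[i]≤j; i<j⇒i≤pred[j]; suc[i]≤j⇒i<j)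
open import Data.Product using (_×_; _,_; ∃₂)
open import Relation.Binary.PropositionalEquality using (_≡_; _≢_; refl; sym; trans; cong; subst)
open import Relation.Nullary using (yes; no; contradiction)
open import Relation.Binary.Construct.Closure.ReflexiveTransitive using (fold)

InRange : Config → ℤ → Set
InRange F v = ∃₂ λ α β → F α ≤ v × v ≤ F β

Spanned : Config → Config → Set
Spanned F F' = ∀ τ → InRange F (F' τ)

spanned-refl : ∀ {F} → Spanned F F
spanned-refl τ = τ , τ , ≤-refl , ≤-refl

spanned-trans : ∀ {F G H} → Spanned F G → Spanned G H → Spanned F H
spanned-trans F⊒G G⊒H τ with G⊒H τ
... | α , β , Gα≤Hτ , Hτ≤Gβ with F⊒G α | F⊒G β
...   | α′ , _ , Fα′≤Gα , _ | _ , β′ , _ , Gβ≤Fβ′ =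
  α′ , β′ , ≤-trans Fα′≤Gα Gα≤Hτ , ≤-trans Hτ≤Gβ Gβ≤Fβ′

update-spanned : ∀ {F G a v} → Spanned F G → InRange F v → Spanned F (update G a v)
update-spanned {a = a} F⊒G v∈F τ with τ ≟F a
... | yes _ = v∈F
... | no  _ = F⊒G τ

update-elsewhere : ∀ {F a v τ} → a ≢ τ → update F a v τ ≡ F τ
update-elsewhere {a = a} {τ = τ} a≢τ with τ ≟F a
... | yes τ≡a = contradiction (sym τ≡a) a≢τ
... | no  _   = refl

spanned-upper : ∀ {F F'} → Spanned F F' →
  (M : ℤ) → ((τ : Face) → F τ ≤ M) → (τ : Face) → F' τ ≤ M
spanned-upper F⊒F' M F≤M τ with F⊒F' τ
... | _ , β , _ , F'τ≤Fβ = ≤-trans F'τ≤Fβ (F≤M β)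

spanned-lower : ∀ {F F'} → Spanned F F' →
  (m : ℤ) → ((τ : Face) → m ≤ F τ) → (τ : Face) → m ≤ F' τ
spanned-lower F⊒F' m m≤F τ with F⊒F' τ
... | α , _ , Fα≤F'τ , _ = ≤-trans (m≤F α) Fα≤F'τ

-- Unit steps on ℤ, in the forms 'i + 1ℤ' and 'i - 1ℤ' used by 'Step'
-- (the library states them for sucℤ i = 1ℤ + i and pred i = -1ℤ + i).
i≤i+1 : ∀ i → i ≤ i + 1ℤ
i≤i+1 i = subst (i ≤_) (+-comm 1ℤ i) (i≤suc[i] i)

i-1≤i : ∀ i → i - 1ℤ ≤ i
i-1≤i i = subst (_≤ i) (+-comm -1ℤ i) (i≤j⇒pred[i]≤j ≤-refl)

<⇒+1≤ : ∀ {i j} → i < j → i + 1ℤ ≤ j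
<⇒+1≤ {i} {j} i<j = subst (_≤ j) (+-comm 1ℤ i) (i<j⇒suc[i]≤j i<j)

<⇒≤-1 : ∀ {i j} → i < j → i ≤ j - 1ℤ
<⇒≤-1 {i} {j} i<j = subst (i ≤_) (+-comm -1ℤ j) (i<j⇒i≤pred[j] i<j)

+1≤⇒< : ∀ {i j} → i + 1ℤ ≤ j → i < j
+1≤⇒< {i} {j} i+1≤j = suc[i]≤j⇒i<j (subst (_≤ j) (+-comm i 1ℤ) i+1≤j)

-- Faces carrying different values are different faces; this rules out
-- that a sink move updates σ itself.
<⇒≢ : ∀ {F : Config} {x y} → F x < F y → x ≢ y
<⇒≢ {F} Fx<Fy x≡y = <-irrefl (cong F x≡y) Fx<Fy

-- Each move writes only values in the range of the old configuration:
-- a firing of a → b writes F a - 1 and F b + 1, both in [F b , F a];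
-- a sink move writes a value between F a and F σ.
step-spanned : ∀ {σ F F'} → Step σ F F' → Spanned F F'
step-spanned {F = F} (fire a b _ _ _ Fb+2≤Fa) =
  update-spanned (update-spanned spanned-refl (b , a , Fb≤Fa-1 , i-1≤i (F a)))
                 (b , a , i≤i+1 (F b) , Fb+1≤Fa)
  where
  Fb≤Fa-1 : F b ≤ F a - 1ℤ
  Fb≤Fa-1 = ≤-trans (i≤i+1 (F b)) (<⇒≤-1 (+1≤⇒< Fb+2≤Fa))
  Fb+1≤Fa : F b + 1ℤ ≤ F a
  Fb+1≤Fa = ≤-trans (i≤i+1 (F b + 1ℤ)) Fb+2≤Fa
step-spanned {σ} {F} (sink-up a _ Fa<Fσ) =
  update-spanned spanned-refl (a , σ , i≤i+1 (F a) , <⇒+1≤ Fa<Fσ)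
step-spanned {σ} {F} (sink-dn a _ Fσ<Fa) =
  update-spanned spanned-refl (σ , a , <⇒≤-1 Fσ<Fa , i-1≤i (F a))

step-fixes-σ : ∀ {σ F F'} → Step σ F F' → F' σ ≡ F σ
step-fixes-σ (fire a b _ a≢σ b≢σ _) =
  trans (update-elsewhere b≢σ) (update-elsewhere a≢σ)
step-fixes-σ {F = F} (sink-up a _ Fa<Fσ) =
  update-elsewhere {F} (<⇒≢ {F} Fa<Fσ)
step-fixes-σ {F = F} (sink-dn a _ Fσ<Fa) =
  update-elsewhere {F} (λ a≡σ → <⇒≢ {F} Fσ<Fa (sym a≡σ))

Controlled : Face → Config → Config → Set
Controlled σ F F' = Spanned F F' × F' σ ≡ F σ

reach-controlled : ∀ {σ F F'} → Reach σ F F' → Controlled σ F F'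
reach-controlled {σ} = fold (Controlled σ) prepend (spanned-refl , refl)
  where
  prepend : ∀ {F G H} → Step σ F G → Controlled σ G H → Controlled σ F H
  prepend s (G⊒H , Hσ≡Gσ) = spanned-trans (step-spanned s) G⊒H , trans Hσ≡Gσ (step-fixes-σ s)

proposition6p1 : (σ : Face) (F F' : Config) → Reach σ F F' →
    ((M : ℤ) → ((τ : Face) → F τ ≤ M) → (τ : Face) → F' τ ≤ M) ×
    ((m : ℤ) → ((τ : Face) → m ≤ F τ) → (τ : Face) → m ≤ F' τ) ×
    F' σ ≡ F σ
proposition6p1 σ F F' r with reach-controlled r
... | F⊒F' , F'σ≡Fσ = spanned-upper F⊒F' , spanned-lower F⊒F' , F'σ≡Fσ
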